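{- In the pebble game on $D$, the sets $A_i$ form a partition of $A$: every arc of $D$ is traversed by exactly one pebble, at exactly one time step.
   Context: Let $D=(V,A)$ be a directed acyclic graph with no isolated vertex, whose vertices are sources $S$ (indegree $0$, outdegree $1$), sinks $T$ (indegree $1$, outdegree $0$), and other vertices whose indegree equals their outdegree. Pebble game: initially there is one pebble on each vertex of $S$. At each time step, every vertex whose number of pebbles equals its outdegree sends its pebbles along its outgoing arcs, exactly one pebble per arc. The game stops when every vertex has a number of pebbles different from its outdegree. Let $A_i$ be the set of arcs along which pebbles move at time step $i$. -}

module Defs where

open import Data.Nat using (ℕ; zero; suc; _+_)
open import Data.Fin using (Fin; zero; suc)
open import Data.Fin.Properties using () renaming (_≟_ to _≟ᶠ_)
open import Data.Nat.Properties using (_≟_)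
open import Data.Bool using (Bool; true; false; if_then_else_)
open import Data.Product using (Σ; ∃; _×_; _,_)
open import Data.Sum using (_⊎_)
open import Data.Empty using (⊥)
open import Relation.Nullary using (¬_)
open import Relation.Nullary.Decidable using (⌊_⌋)
open import Relation.Binary.PropositionalEquality using (_≡_)
open import Relation.Binary.Construct.Closure.Transitive using (TransClosure)

count : ∀ {m} → (Fin m → Bool) → ℕ
count {zero}  P = 0
count {suc m} P = (if P zero then 1 else 0) + count (λ i → P (suc i))

record Digraph : Set where
  field
    n    : ℕ
    m    : ℕ
    tail : Fin m → Fin n
    head : Fin m → Fin n
open Digraph public

Vertex : Digraph → Set
Vertex D = Fin (n D)

Arc : Digraph → Set
Arc D = Fin (m D)

-- No two arcs with the same tail and the same head: A ⊆ V × V.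
Simple : Digraph → Set
Simple D = ∀ a b → tail D a ≡ tail D b → head D a ≡ head D b → a ≡ b

Edge : (D : Digraph) → Vertex D → Vertex D → Set
Edge D u v = ∃ λ a → tail D a ≡ u × head D a ≡ v

Acyclic : Digraph → Set
Acyclic D = ∀ v → ¬ TransClosure (Edge D) v v

outdeg : (D : Digraph) → Vertex D → ℕ
outdeg D v = count (λ a → ⌊ tail D a ≟ᶠ v ⌋)

indeg : (D : Digraph) → Vertex D → ℕ
indeg D v = count (λ a → ⌊ head D a ≟ᶠ v ⌋)

VertexTypes : Digraph → Set
VertexTypes D = ∀ v →
  (indeg D v ≡ 0 × outdeg D v ≡ 1) ⊎
  (indeg D v ≡ 1 × outdeg D v ≡ 0) ⊎
  (indeg D v ≡ outdeg D v)

NoIsolated : Digraph → Set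
NoIsolated D = ∀ v → ¬ (indeg D v ≡ 0 × outdeg D v ≡ 0)

Config : Digraph → Set
Config D = Vertex D → ℕ

fires : (D : Digraph) → Config D → Vertex D → Bool
fires D p v = ⌊ p v ≟ outdeg D v ⌋

initial : (D : Digraph) → Config D
initial D v = if ⌊ indeg D v ≟ 0 ⌋ then 1 else 0

-- One synchronous time step: every firing vertex sends one pebble along
-- each outgoing arc (so keeps none); each vertex receives one pebble per
-- incoming arc whose tail fires.  (If no vertex fires -- the game has
-- stopped -- the configuration is unchanged.)
step : (D : Digraph) → Config D → Config D
step D p v =
  (if fires D p v then 0 else p v) +
  count (λ a → if ⌊ head D a ≟ᶠ v ⌋ then fires D p (tail D a) else false)

config : (D : Digraph) → ℕ → Config D
config D zero    = initial D
config D (suc k) = step D (config D k)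

-- a ∈ A_t : a pebble moves along arc a at time step t (t = 1, 2, ...),
-- i.e. the tail of a fires in the configuration after t - 1 steps.
InA : (D : Digraph) → ℕ → Arc D → Set
InA D zero    a = ⊥
InA D (suc k) a = config D k (tail D a) ≡ outdeg D (tail D a)

-- Every vertex of positive outdegree fires exactly once, by well-founded
-- induction along the arcs (the graph is finite and acyclic).  If all
-- in-neighbours of v fire exactly once, the pebbles of v form a counter that
-- accumulates the arrivals until it first holds outdeg v, is then emptied,
-- and receives nothing afterwards: the initial pebble plus the indegree of v
-- is exactly outdeg v, so all of its input has arrived by then.  An arc is
-- traversed precisely when its tail fires.

module Submission where

open import Defs
open import Data.Nat using (ℕ; zero; suc; _+_; _≤_; _<_; _≤′_; ≤′-refl; ≤′-step; _⊔_; z≤n; s≤s; s<s; z<s; _<ᵇ_; _≡ᵇ_)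
open import Data.Nat.Properties
  using (module ≤-Reasoning; _≟_; _<?_; +-assoc; +-identityʳ; +-mono-≤; +-monoʳ-≤; +-cancelˡ-≤; ≤-refl; ≤-trans; ≤-reflexive;
         <⇒≤; n≤1+n; n<1+n; n≤0⇒n≡0; m≤m⊔n; m≤n⊔m; m<1+n⇒m<n∨m≡n; m≤n⇒m<n∨m≡n; ≤⇒≤′; <-cmp;
         +-commutativeSemigroup)
open import Algebra.Properties.CommutativeSemigroup +-commutativeSemigroup using (interchange)
open import Data.Fin using (Fin; zero; suc) renaming (_<_ to _<ᶠ_)
open import Data.Fin.Properties using (any?; all?; ¬∀⟶∃¬; pigeonhole) renaming (_≟_ to _≟ᶠ_)
open import Data.Vec.Functional using (_∷_)
open import Data.Bool using (Bool; true; false; if_then_else_)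
open import Data.Product using (∃; ∃!; _×_; _,_; proj₁; proj₂)
import Data.Product as Product
open import Data.Sum using (_⊎_; inj₁; inj₂; [_,_]′)
open import Data.Empty using (⊥)
open import Function using (_∘_; id; const; _⇔_; mk⇔; Equivalence)
open import Level using (0ℓ)
open import Relation.Nullary using (¬_; Dec; yes; no; contradiction)
open import Relation.Nullary.Decidable using (⌊_⌋; isYes≗does; dec-true; dec-false; does-⇔; _×-dec_; _→-dec_)
open import Relation.Unary using (Pred)
open import Relation.Binary using (Rel; Decidable; tri<; tri≈; tri>)
open import Relation.Binary.PropositionalEquality
open import Relation.Binary.Construct.Closure.Transitive using (TransClosure; [_]; _∷ʳ_)
open import Induction.WellFounded using (Acc; acc; WellFounded)

𝟙 : Bool → ℕ
𝟙 b = if b then 1 else 0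

count-cong : ∀ {m} {P Q : Fin m → Bool} → (∀ i → P i ≡ Q i) → count P ≡ count Q
count-cong {zero}  _   = refl
count-cong {suc m} P≗Q = cong₂ _+_ (cong 𝟙 (P≗Q zero)) (count-cong (P≗Q ∘ suc))

count-+ : ∀ {m} {P Q R : Fin m → Bool} →
  (∀ i → 𝟙 (P i) ≡ 𝟙 (Q i) + 𝟙 (R i)) → count P ≡ count Q + count R
count-+ {zero}  _ = refl
count-+ {suc m} {Q = Q} {R} split =
  trans (cong₂ _+_ (split zero) (count-+ (split ∘ suc)))
        (interchange (𝟙 (Q zero)) (𝟙 (R zero)) (count (Q ∘ suc)) (count (R ∘ suc)))

count-mono : ∀ {m} {P Q : Fin m → Bool} → (∀ i → P i ≡ true → Q i ≡ true) → count P ≤ count Q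
count-mono {zero}  _   = z≤n
count-mono {suc m} P⇒Q = +-mono-≤ (𝟙-mono (P⇒Q zero)) (count-mono (P⇒Q ∘ suc))
  where
  𝟙-mono : ∀ {a b} → (a ≡ true → b ≡ true) → 𝟙 a ≤ 𝟙 b
  𝟙-mono {false} _   = z≤n
  𝟙-mono {true}  a⇒b rewrite a⇒b refl = ≤-refl

count-false : ∀ {m} {P : Fin m → Bool} → (∀ i → P i ≡ false) → count P ≡ 0
count-false {zero}          _ = refl
count-false {suc m} {P} P≗false rewrite P≗false zero = count-false (P≗false ∘ suc)

count≡0⇒false : ∀ {m} {P : Fin m → Bool} → count P ≡ 0 → ∀ i → P i ≡ false
count≡0⇒false {suc m} {P} count≡0 i with P zero in P₀
count≡0⇒false {suc m} {P} count≡0 zero    | false = P₀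
count≡0⇒false {suc m} {P} count≡0 (suc i) | false = count≡0⇒false {P = P ∘ suc} count≡0 i

⌊⌋-false : ∀ {a} {A : Set a} (a? : Dec A) → ¬ A → ⌊ a? ⌋ ≡ false
⌊⌋-false a? ¬a = trans (isYes≗does a?) (dec-false a? ¬a)

⌊⌋-true : ∀ {a} {A : Set a} (a? : Dec A) → A → ⌊ a? ⌋ ≡ true
⌊⌋-true a? a = trans (isYes≗does a?) (dec-true a? a)

𝟙-<ᵇ-suc : ∀ t k → 𝟙 (t <ᵇ suc k) ≡ 𝟙 (t <ᵇ k) + 𝟙 (k ≡ᵇ t)
𝟙-<ᵇ-suc zero    zero    = refl
𝟙-<ᵇ-suc zero    (suc k) = refl
𝟙-<ᵇ-suc (suc t) zero    = refl
𝟙-<ᵇ-suc (suc t) (suc k) = 𝟙-<ᵇ-suc t k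

finite-bounded : ∀ {m} (f : Fin m → ℕ) → ∃ λ K → ∀ i → f i < K
finite-bounded {zero}  f = 0 , λ ()
finite-bounded {suc m} f with finite-bounded (f ∘ suc)
... | K , f∘suc<K = suc (f zero ⊔ K) , λ
  { zero    → s≤s (m≤m⊔n (f zero) K)
  ; (suc i) → ≤-trans (f∘suc<K i) (≤-trans (m≤n⊔m (f zero) K) (n≤1+n _)) }

minimal-witness : ∀ {p} {P : Pred ℕ p} → (∀ k → Dec (P k)) →
  ∀ {K} → P K → ∃ λ T → P T × (∀ {k} → k < T → ¬ P k)
minimal-witness {P = P} P? {K} P[K] with search (suc K)
  where
  search : ∀ N → (∃ λ T → P T × (∀ {k} → k < T → ¬ P k)) ⊎ (∀ {k} → k < N → ¬ P k)
  search zero = inj₂ λ ()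
  search (suc N) with search N | P? N
  ... | inj₁ found | _       = inj₁ found
  ... | inj₂ none  | yes P[N] = inj₁ (N , P[N] , none)
  ... | inj₂ none  | no ¬P[N] = inj₂ λ k<1+N → [ none , (λ { refl → ¬P[N] }) ]′ (m<1+n⇒m<n∨m≡n k<1+N)
... | inj₁ found = found
... | inj₂ none  = contradiction P[K] (none (n<1+n K))

module _ {n} {_⇒_ : Rel (Fin n) 0ℓ} (_⇒?_ : Decidable _⇒_) where

  AccWithin : ℕ → Fin n → Set
  AccWithin zero    v = ⊥
  AccWithin (suc k) v = ∀ u → u ⇒ v → AccWithin k u

  accWithin? : ∀ k v → Dec (AccWithin k v)
  accWithin? zero    v = no id
  accWithin? (suc k) v = all? λ u → u ⇒? v →-dec accWithin? k u

  accWithin⇒acc : ∀ k {v} → AccWithin k v → Acc _⇒_ v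
  accWithin⇒acc (suc k) accW = acc λ {u} u⇒v → accWithin⇒acc k (accW u u⇒v)

  Descending : ∀ {k} → (Fin k → Fin n) → Set
  Descending f = ∀ {i j} → i <ᶠ j → TransClosure _⇒_ (f j) (f i)

  descending-∷ : ∀ {k u v} {f : Fin k → Fin n} → u ⇒ v → Descending (u ∷ f) → Descending (v ∷ u ∷ f)
  descending-∷ u⇒v desc {zero}  {suc zero}    _         = [ u⇒v ]
  descending-∷ u⇒v desc {zero}  {suc (suc j)} _         = desc {zero} {suc j} z<s ∷ʳ u⇒v
  descending-∷ u⇒v desc {suc i} {suc j}       (s<s i<j) = desc i<j

  descending-of-¬accWithin : ∀ k {v} → ¬ AccWithin k v → ∃ λ (f : Fin k → Fin n) → Descending (v ∷ f)
  descending-of-¬accWithin zero    _ = (λ ()) , λ { {zero} {zero} () }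
  descending-of-¬accWithin (suc k) {v} ¬accW
    with ¬∀⟶∃¬ n _ (λ u → u ⇒? v →-dec accWithin? k u) ¬accW
  ... | u , ¬[u⇒v→accW] with u ⇒? v
  ...   | no ¬u⇒v = contradiction (λ u⇒v → contradiction u⇒v ¬u⇒v) ¬[u⇒v→accW]
  ...   | yes u⇒v =
    Product.map (u ∷_) (descending-∷ u⇒v) (descending-of-¬accWithin k (¬[u⇒v→accW] ∘ const))

  -- A descending chain of n + 1 vertices of Fin n repeats a vertex, which closes a cycle.
  acyclic⇒wellFounded : (∀ v → ¬ TransClosure _⇒_ v v) → WellFounded _⇒_
  acyclic⇒wellFounded acyclic v with accWithin? n v
  ... | yes accW = accWithin⇒acc n accW
  ... | no ¬accW with descending-of-¬accWithin n ¬accW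
  ...   | f , desc with pigeonhole (n<1+n n) (v ∷ f)
  ...     | i , j , i<j , same = contradiction (subst (TransClosure _⇒_ _) same (desc i<j)) (acyclic _)

-- A counter c that receives g k at step k and is emptied whenever it holds d;
-- r k is its initial content plus everything received before step k.
module ResetCounter
  (d : ℕ) (d≢0 : d ≢ 0) (c r g : ℕ → ℕ)
  (c₀ : c 0 ≡ r 0)
  (c-suc : ∀ k → c (suc k) ≡ (if ⌊ c k ≟ d ⌋ then 0 else c k) + g k)
  (r-suc : ∀ k → r (suc k) ≡ r k + g k)
  (r≤d : ∀ k → r k ≤ d)
  {K : ℕ} (r[K]≡d : r K ≡ d)
  where

  private
    first-full : ∃ λ T → r T ≡ d × (∀ {k} → k < T → r k ≢ d)
    first-full = minimal-witness (λ k → r k ≟ d) r[K]≡d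

    T : ℕ
    T = proj₁ first-full

    r[T]≡d : r T ≡ d
    r[T]≡d = proj₁ (proj₂ first-full)

    not-full-before-T : ∀ {k} → k < T → r k ≢ d
    not-full-before-T = proj₂ (proj₂ first-full)

    no-input-when-full : ∀ {k} → r k ≡ d → g k ≡ 0
    no-input-when-full {k} full = n≤0⇒n≡0 (+-cancelˡ-≤ d (g k) 0 (begin
      d + g k   ≡⟨ cong (_+ g k) full ⟨
      r k + g k ≡⟨ r-suc k ⟨
      r (suc k) ≤⟨ r≤d (suc k) ⟩
      d         ≡⟨ +-identityʳ d ⟨
      d + 0     ∎))
      where open ≤-Reasoning

    full-from-T : ∀ {k} → T ≤ k → r k ≡ d
    full-from-T = full ∘ ≤⇒≤′
      where
      full : ∀ {k} → T ≤′ k → r k ≡ d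
      full ≤′-refl = r[T]≡d
      full {suc k} (≤′-step T≤′k) = begin
        r (suc k) ≡⟨ r-suc k ⟩
        r k + g k ≡⟨ cong₂ _+_ r[k]≡d (no-input-when-full r[k]≡d) ⟩
        d + 0     ≡⟨ +-identityʳ d ⟩
        d         ∎
        where
        open ≡-Reasoning
        r[k]≡d = full T≤′k

    c≡r-until-T : ∀ {k} → k ≤ T → c k ≡ r k
    c≡r-until-T {zero}  _   = c₀
    c≡r-until-T {suc k} k<T = begin
      c (suc k)                               ≡⟨ c-suc k ⟩
      (if ⌊ c k ≟ d ⌋ then 0 else c k) + g k  ≡⟨ cong (λ b → (if b then 0 else c k) + g k) (⌊⌋-false (c k ≟ d) c[k]≢d) ⟩
      c k + g k                               ≡⟨ cong (_+ g k) c[k]≡r[k] ⟩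
      r k + g k                               ≡⟨ r-suc k ⟨
      r (suc k)                               ∎
      where
      open ≡-Reasoning
      c[k]≡r[k] = c≡r-until-T (<⇒≤ k<T)
      c[k]≢d = not-full-before-T k<T ∘ trans (sym c[k]≡r[k])

    c≡0-after-T : ∀ {k} → T < k → c k ≡ 0
    c≡0-after-T {suc k} (s≤s T≤k) = begin
      c (suc k)                               ≡⟨ c-suc k ⟩
      (if ⌊ c k ≟ d ⌋ then 0 else c k) + g k  ≡⟨ cong₂ _+_ (emptied (c k ≟ d)) (no-input-when-full (full-from-T T≤k)) ⟩
      0                                       ∎
      where
      open ≡-Reasoning
      emptied : (c[k]≟d : Dec (c k ≡ d)) → (if ⌊ c[k]≟d ⌋ then 0 else c k) ≡ 0
      emptied (yes _) = refl
      emptied (no c[k]≢d) with m≤n⇒m<n∨m≡n T≤k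
      ... | inj₁ T<k  = c≡0-after-T T<k
      ... | inj₂ refl = contradiction (trans (c≡r-until-T ≤-refl) r[T]≡d) c[k]≢d

  hits-threshold-once : ∃ λ T → ∀ k → c k ≡ d ⇔ k ≡ T
  hits-threshold-once = T , λ k → mk⇔ (only-at-T k) λ { refl → trans (c≡r-until-T ≤-refl) r[T]≡d }
    where
    only-at-T : ∀ k → c k ≡ d → k ≡ T
    only-at-T k c[k]≡d with <-cmp k T
    ... | tri< k<T _ _ = contradiction (trans (sym (c≡r-until-T (<⇒≤ k<T))) c[k]≡d) (not-full-before-T k<T)
    ... | tri≈ _ k≡T _ = k≡T
    ... | tri> _ _ T<k = contradiction (trans (sym c[k]≡d) (c≡0-after-T T<k)) d≢0

module _ (D : Digraph) where

  FiresOnlyAt : Vertex D → ℕ → Set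
  FiresOnlyAt v T = ∀ k → config D k v ≡ outdeg D v ⇔ k ≡ T

  edge? : Decidable (Edge D)
  edge? u v = any? λ a → (tail D a ≟ᶠ u) ×-dec (head D a ≟ᶠ v)

  outdeg-tail≢0 : ∀ a → outdeg D (tail D a) ≢ 0
  outdeg-tail≢0 a outdeg≡0 with trans (sym (⌊⌋-true (tail D a ≟ᶠ tail D a) refl)) (count≡0⇒false outdeg≡0 a)
  ... | ()

  initial+indeg≡outdeg : VertexTypes D → ∀ v → outdeg D v ≢ 0 → initial D v + indeg D v ≡ outdeg D v
  initial+indeg≡outdeg types v out≢0 with types v
  ... | inj₁ (in≡0 , out≡1)      rewrite in≡0 | out≡1 = refl
  ... | inj₂ (inj₁ (_ , out≡0)) = contradiction out≡0 out≢0
  ... | inj₂ (inj₂ in≡out)      = trans (cong (λ b → 𝟙 b + indeg D v) no-pebble) in≡out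
    where
    no-pebble : ⌊ indeg D v ≟ 0 ⌋ ≡ false
    no-pebble = ⌊⌋-false (indeg D v ≟ 0) (out≢0 ∘ trans (sym in≡out))

  incoming : Vertex D → (Arc D → Bool) → Arc D → Bool
  incoming v P a = if ⌊ head D a ≟ᶠ v ⌋ then P a else false

  incoming-cong : ∀ {v} {P Q : Arc D → Bool} → (∀ a → head D a ≡ v → P a ≡ Q a) →
    ∀ a → incoming v P a ≡ incoming v Q a
  incoming-cong {v} P≗Q a with head D a ≟ᶠ v
  ... | yes a↦v = P≗Q a a↦v
  ... | no  _   = refl

  incoming-false : ∀ {v} a → incoming v (const false) a ≡ false
  incoming-false {v} a with head D a ≟ᶠ v
  ... | yes _ = refl
  ... | no  _ = refl

  incoming⇒head : ∀ {v P} a → incoming v P a ≡ true → ⌊ head D a ≟ᶠ v ⌋ ≡ true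
  incoming⇒head {v} a _ with head D a ≟ᶠ v
  incoming⇒head {v} a () | no _
  ... | yes _ = refl

  module _ {v : Vertex D} {T : Arc D → ℕ} (inputs : ∀ a → head D a ≡ v → FiresOnlyAt (tail D a) (T a)) where

    inflow : ℕ → ℕ
    inflow k = count (incoming v λ a → fires D (config D k) (tail D a))

    received : ℕ → ℕ
    received k = count (incoming v λ a → T a <ᵇ k)

    inflow≡arrivals : ∀ k → inflow k ≡ count (incoming v λ a → k ≡ᵇ T a)
    inflow≡arrivals k = count-cong (incoming-cong tail-fires-at-T)
      where
      tail-fires-at-T : ∀ a → head D a ≡ v → fires D (config D k) (tail D a) ≡ (k ≡ᵇ T a)
      tail-fires-at-T a a↦v = trans (isYes≗does fires?) (does-⇔ (inputs a a↦v k) fires? (k ≟ T a))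
        where fires? = config D k (tail D a) ≟ outdeg D (tail D a)

    received-0 : received 0 ≡ 0
    received-0 = count-false incoming-false

    received-suc : ∀ k → received (suc k) ≡ received k + inflow k
    received-suc k = trans (count-+ split) (cong (received k +_) (sym (inflow≡arrivals k)))
      where
      split : ∀ a → 𝟙 (incoming v (λ a → T a <ᵇ suc k) a)
                  ≡ 𝟙 (incoming v (λ a → T a <ᵇ k) a) + 𝟙 (incoming v (λ a → k ≡ᵇ T a) a)
      split a with head D a ≟ᶠ v
      ... | yes _ = 𝟙-<ᵇ-suc (T a) k
      ... | no  _ = refl

    received≤indeg : ∀ k → received k ≤ indeg D v
    received≤indeg k = count-mono incoming⇒head

    received-eventually : ∃ λ K → received K ≡ indeg D v
    received-eventually with finite-bounded T
    ... | K , T<K = K , count-cong all-arrived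
      where
      all-arrived : ∀ a → incoming v (λ a → T a <ᵇ K) a ≡ ⌊ head D a ≟ᶠ v ⌋
      all-arrived a with head D a ≟ᶠ v
      ... | yes _ = dec-true (T a <? K) (T<K a)
      ... | no  _ = refl

    fires-once-given-inputs : initial D v + indeg D v ≡ outdeg D v → outdeg D v ≢ 0 → ∃ (FiresOnlyAt v)
    fires-once-given-inputs balance out≢0 = ResetCounter.hits-threshold-once
      (outdeg D v) out≢0 (λ k → config D k v) (λ k → initial D v + received k) inflow
      (sym (trans (cong (initial D v +_) received-0) (+-identityʳ _)))
      (λ _ → refl)
      (λ k → trans (cong (initial D v +_) (received-suc k)) (sym (+-assoc (initial D v) (received k) (inflow k))))
      (λ k → ≤-trans (+-monoʳ-≤ (initial D v) (received≤indeg k)) (≤-reflexive balance))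
      {K = proj₁ received-eventually} (trans (cong (initial D v +_) (proj₂ received-eventually)) balance)

  fires-once : VertexTypes D → ∀ {v} → Acc (Edge D) v → outdeg D v ≢ 0 → ∃ (FiresOnlyAt v)
  fires-once types {v} (acc earlier) out≢0 =
    fires-once-given-inputs (λ a → proj₂ (firing-time a (head D a ≟ᶠ v)))
      (initial+indeg≡outdeg types v out≢0) out≢0
    where
    firing-time : ∀ a → Dec (head D a ≡ v) → ∃ λ t → head D a ≡ v → FiresOnlyAt (tail D a) t
    firing-time a (yes a↦v) = Product.map₂ const (fires-once types (earlier (a , refl , a↦v)) (outdeg-tail≢0 a))
    firing-time a (no a↦̸v) = 0 , λ a↦v → contradiction a↦v a↦̸v

lemma3p5 : (D : Digraph) → Simple D → Acyclic D → VertexTypes D → NoIsolated D →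
    ∀ (a : Arc D) → ∃! _≡_ (λ (t : ℕ) → InA D t a)
lemma3p5 D _ acyclic types _ a = suc T , Equivalence.from (fires-only-at-T T) refl , only-at-suc-T
  where
  tail-fires-once : ∃ (FiresOnlyAt D (tail D a))
  tail-fires-once = fires-once D types (acyclic⇒wellFounded (edge? D) acyclic (tail D a)) (outdeg-tail≢0 D a)

  T : ℕ
  T = proj₁ tail-fires-once

  fires-only-at-T : FiresOnlyAt D (tail D a) T
  fires-only-at-T = proj₂ tail-fires-once

  only-at-suc-T : ∀ {t} → InA D t a → suc T ≡ t
  only-at-suc-T {suc t} fired = cong suc (sym (Equivalence.to (fires-only-at-T t) fired))
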